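{- Let $G=\{0,\tfrac1X,\dots,1\}^d$, let $S_0$ be a finite multiset of points of $G$, let $x,y\in G$, and set $S_1=S_0\cup\{x\}$, $S_2=S_0\cup\{y\}$. Then for each $j=0,\dots,d-1$ and every $j$-dimensional affine subspace $f$ spanned by $j+1$ affinely independent points of $G$, we have $|s_{S_1}(f)-s_{S_2}(f)|\le2$.
   Context: For a multiset $S$ and affine subspace $f$, $c_S(f)$ is the number of points of $S$ (with multiplicity) in $f$. $M_i(S)=\max\{c_S(f): f$ affine subspace spanned by a subset of $S$, of dimension at most $i\}$. The score of a $j$-dimensional subspace $f$ is $s_S(f)=\max\{0,\,c_S(f)-M_{j-1}(S)\}$ if $j\ge1$, and $s_S(f)=c_S(f)$ if $j=0$. -}

module Defs where

open import Data.Nat as ℕ using (ℕ; zero; suc; _≤_; _∸_; NonZero)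
open import Data.Fin using (Fin; zero; suc; toℕ)
open import Data.Vec using (Vec; lookup)
open import Data.List using (List; []; _∷_)
open import Data.List.Membership.Propositional using (_∈_)
open import Data.Integer using (+_)
open import Data.Rational using (ℚ; 0ℚ; 1ℚ; _+_; _*_; _/_)
open import Data.Product using (Σ; _×_; ∃)
open import Data.Sum using (_⊎_)
open import Relation.Binary.PropositionalEquality using (_≡_)
open import Relation.Nullary using (¬_)

sumℚ : ∀ {n} → (Fin n → ℚ) → ℚ
sumℚ {zero}  f = 0ℚ
sumℚ {suc n} f = f zero + sumℚ (λ i → f (suc i))

ℚPt : ℕ → Set
ℚPt d = Fin d → ℚ

-- Grid G = {0, 1/X, ..., 1}^d : a point is given by its numerators k ∈ {0..X}.
GPt : ℕ → ℕ → Set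
GPt d X = Vec (Fin (suc X)) d

emb : ∀ {d X} .{{_ : NonZero X}} → GPt d X → ℚPt d
emb {X = X} p i = (+ toℕ (lookup p i)) / X

InSpan : ∀ {d k} → (Fin (suc k) → ℚPt d) → ℚPt d → Set
InSpan {d} {k} q p =
  Σ (Fin (suc k) → ℚ) λ c →
    (sumℚ c ≡ 1ℚ) × (∀ (i : Fin d) → sumℚ (λ l → c l * q l i) ≡ p i)

AffInd : ∀ {d k} → (Fin (suc k) → ℚPt d) → Set
AffInd {d} {k} q =
  ∀ (c : Fin (suc k) → ℚ) → sumℚ c ≡ 0ℚ →
    (∀ (i : Fin d) → sumℚ (λ l → c l * q l i) ≡ 0ℚ) → ∀ l → c l ≡ 0ℚ

-- A j-dimensional affine subspace spanned by grid points: represented by an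
-- affinely independent family of j+1 grid points (its affine basis).
module _ {d X : ℕ} .{{_ : NonZero X}} where

  embF : ∀ {k} → (Fin (suc k) → GPt d X) → Fin (suc k) → ℚPt d
  embF q l = emb (q l)

  data CountIs {k : ℕ} (q : Fin (suc k) → GPt d X) : List (GPt d X) → ℕ → Set where
    cnt-nil : CountIs q [] 0
    cnt-in  : ∀ {p S n} → InSpan (embF q) (emb p) → CountIs q S n → CountIs q (p ∷ S) (suc n)
    cnt-out : ∀ {p S n} → ¬ InSpan (embF q) (emb p) → CountIs q S n → CountIs q (p ∷ S) n

  BasisFrom : ∀ {k} → List (GPt d X) → (Fin (suc k) → GPt d X) → Set
  BasisFrom S q = (∀ l → q l ∈ S) × AffInd (embF q)

  -- M_i(S) = m : m is the maximum of c_S(f) over affine subspaces f of dimension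
  -- at most i spanned by a subset of S (maximum of the empty set taken as 0).
  IsM : ℕ → List (GPt d X) → ℕ → Set
  IsM i S m =
    ( m ≡ 0
      ⊎ Σ ℕ λ k → k ≤ i × Σ (Fin (suc k) → GPt d X) λ q → BasisFrom S q × CountIs q S m )
    × (∀ k → k ≤ i → (q : Fin (suc k) → GPt d X) → BasisFrom S q →
         ∀ n → CountIs q S n → n ≤ m)

  data Score (S : List (GPt d X)) : (j : ℕ) → (Fin (suc j) → GPt d X) → ℕ → Set where
    score-zero : ∀ {q c} → CountIs q S c → Score S zero q c
    score-suc  : ∀ {j q c m} → CountIs q S c → IsM j S m → Score S (suc j) q (c ∸ m)

module Submission where

-- Write S₁ = x ∷ S₀ and S₂ = y ∷ S₀.  For a fixed subspace f the count c_S(f) changes by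
-- at most one (count-swap), so for j = 0 we are done.  For j ≥ 1 the score is
-- c_S(f) ∸ M_{j-1}(S), and it suffices to show M_{j-1}(S₁) ≤ M_{j-1}(S₂) + 1 (M-swap).
-- Take a subspace f = span q of dimension ≤ j-1 spanned by S₁ attaining M_{j-1}(S₁).  It
-- contains at most one point more of S₁ than of S₀, and we "reduce" it to S₀: either all
-- points of q are in S₀; or q l = x is the only point outside S₀, and then either some point
-- of S₀ in f has nonzero weight on q l and replaces it (exchange lemma), or no point of S₀
-- in f uses q l and we drop q l.  The resulting subspace is spanned by S₀ ⊆ S₂ and contains
-- all points of S₀ in f, so c_{S₀}(f) ≤ M_{j-1}(S₂).

open import Defs
open import Data.Nat using (ℕ; suc; _<_; _≤_; NonZero; ∣_-_∣)
open import Data.Fin using (Fin)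
open import Data.List using (List; _∷_)
open import Data.List using ([])

module AffineAlgebra where

  open import Data.Nat using (zero)
  open import Data.Fin using (zero; suc; punchIn; punchOut)
  import Data.Fin.Properties as Fin
  open import Data.Vec.Functional using (insertAt)
  open import Data.Vec.Functional.Properties using (insertAt-lookup; insertAt-punchIn)
  open import Data.Rational using (ℚ; 0ℚ; 1ℚ; _+_; _*_; -_; 1/_; ≢-nonZero)
  open import Data.Rational.Properties
    using (+-identityˡ; +-identityʳ; *-zeroˡ; *-identityʳ; *-assoc; *-inverseˡ; *-inverseʳ; 1≢0)
  open import Data.Rational.Solver using (module +-*-Solver)
  open +-*-Solver
  open import Data.Product using (_×_; _,_; proj₁; proj₂)
  open import Function using (_∘_)
  open import Relation.Binary.PropositionalEquality
  open import Relation.Nullary using (¬_; yes; no)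

  every-index : ∀ {n} {P : Fin (suc n) → Set} (l : Fin (suc n)) →
    P l → (∀ i → P (punchIn l i)) → ∀ j → P j
  every-index {P = P} l Pl Prest j with l Fin.≟ j
  ... | yes refl = Pl
  ... | no l≢j = subst P (Fin.punchIn-punchOut l≢j) (Prest (punchOut l≢j))

  *-cancel-nonzero : ∀ {c x} → x ≢ 0ℚ → c * x ≡ 0ℚ → c ≡ 0ℚ
  *-cancel-nonzero {c} {x} x≢0 cx≡0 = begin
      c                ≡⟨ sym (*-identityʳ c) ⟩
      c * 1ℚ           ≡⟨ cong (c *_) (sym (*-inverseʳ x)) ⟩
      c * (x * 1/ x)   ≡⟨ sym (*-assoc c x _) ⟩
      (c * x) * 1/ x   ≡⟨ cong (_* 1/ x) cx≡0 ⟩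
      0ℚ * 1/ x        ≡⟨ *-zeroˡ (1/ x) ⟩
      0ℚ               ∎
    where
      open ≡-Reasoning
      instance _ = ≢-nonZero x≢0

  sum-cong : ∀ {n} {f g : Fin n → ℚ} → (∀ i → f i ≡ g i) → sumℚ f ≡ sumℚ g
  sum-cong {zero}  f≡g = refl
  sum-cong {suc n} f≡g = cong₂ _+_ (f≡g zero) (sum-cong (f≡g ∘ suc))

  sum-zero : ∀ {n} → sumℚ {n} (λ _ → 0ℚ) ≡ 0ℚ
  sum-zero {zero}  = refl
  sum-zero {suc n} = trans (+-identityˡ _) (sum-zero {n})

  sum-scale : ∀ {n} (r : ℚ) (g : Fin n → ℚ) → sumℚ (λ i → r * g i) ≡ r * sumℚ g
  sum-scale {zero}  r g = solve 1 (λ r → con 0ℚ := r :* con 0ℚ) refl r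
  sum-scale {suc n} r g =
    trans (cong (r * g zero +_) (sum-scale r (g ∘ suc)))
          (solve 3 (λ r x s → r :* x :+ r :* s := r :* (x :+ s)) refl r (g zero) _)

  sum-linear : ∀ {n} (f g : Fin n → ℚ) (r : ℚ) →
    sumℚ (λ i → f i + r * g i) ≡ sumℚ f + r * sumℚ g
  sum-linear {zero}  f g r = solve 1 (λ r → con 0ℚ := con 0ℚ :+ r :* con 0ℚ) refl r
  sum-linear {suc n} f g r =
    trans (cong (f zero + r * g zero +_) (sum-linear (f ∘ suc) (g ∘ suc) r))
          (solve 5 (λ r a b F G → (a :+ r :* b) :+ (F :+ r :* G) := (a :+ F) :+ r :* (b :+ G))
                 refl r (f zero) (g zero) _ _)

  sum-punchIn : ∀ {n} (l : Fin (suc n)) (g : Fin (suc n) → ℚ) →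
    sumℚ g ≡ g l + sumℚ (g ∘ punchIn l)
  sum-punchIn zero    g = refl
  sum-punchIn {suc n} (suc l) g =
    trans (cong (g zero +_) (sum-punchIn l (g ∘ suc)))
          (solve 3 (λ a b c → a :+ (b :+ c) := b :+ (a :+ c)) refl (g zero) (g (suc l)) _)

  sum-drop-zero : ∀ {n} (l : Fin (suc n)) (g : Fin (suc n) → ℚ) → g l ≡ 0ℚ →
    sumℚ (g ∘ punchIn l) ≡ sumℚ g
  sum-drop-zero l g gl≡0 = begin
      sumℚ (g ∘ punchIn l)        ≡⟨ sym (+-identityˡ _) ⟩
      0ℚ + sumℚ (g ∘ punchIn l)   ≡⟨ cong (_+ sumℚ (g ∘ punchIn l)) (sym gl≡0) ⟩
      g l + sumℚ (g ∘ punchIn l)  ≡⟨ sym (sum-punchIn l g) ⟩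
      sumℚ g                      ∎
    where open ≡-Reasoning

  sum-insertAt : ∀ {n} (f : Fin n → ℚ) (l : Fin (suc n)) (v : ℚ) →
    sumℚ (insertAt f l v) ≡ v + sumℚ f
  sum-insertAt f l v =
    trans (sum-punchIn l (insertAt f l v))
          (cong₂ _+_ (insertAt-lookup f l v) (sum-cong (insertAt-punchIn f l v)))

  comb : ∀ {d n} → (Fin n → ℚPt d) → (Fin n → ℚ) → ℚPt d
  comb Q c t = sumℚ (λ i → c i * Q i t)

  module _ {d : ℕ} where

    comb-zero : ∀ {n} (Q : Fin n → ℚPt d) t → comb Q (λ _ → 0ℚ) t ≡ 0ℚ
    comb-zero {n} Q t = trans (sum-cong (λ i → *-zeroˡ (Q i t))) (sum-zero {n})

    comb-scale : ∀ {n} (Q : Fin n → ℚPt d) (r : ℚ) (a : Fin n → ℚ) t →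
      comb Q (λ i → r * a i) t ≡ r * comb Q a t
    comb-scale Q r a t =
      trans (sum-cong (λ i → *-assoc r (a i) (Q i t))) (sum-scale r (λ i → a i * Q i t))

    comb-linear : ∀ {n} (Q : Fin n → ℚPt d) (c a : Fin n → ℚ) (r : ℚ) t →
      comb Q (λ i → c i + r * a i) t ≡ comb Q c t + r * comb Q a t
    comb-linear Q c a r t =
      trans (sum-cong (λ i → solve 4 (λ c r a q → (c :+ r :* a) :* q := c :* q :+ r :* (a :* q))
                                     refl (c i) r (a i) (Q i t)))
            (sum-linear (λ i → c i * Q i t) (λ i → a i * Q i t) r)

    comb-insertAt : ∀ {n} (Q : Fin (suc n) → ℚPt d) (c : Fin n → ℚ) l v t →
      comb Q (insertAt c l v) t ≡ v * Q l t + comb (Q ∘ punchIn l) c t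
    comb-insertAt Q c l v t =
      trans (sum-punchIn l (λ i → insertAt c l v i * Q i t))
            (cong₂ _+_ (cong (_* Q l t) (insertAt-lookup c l v))
                       (sum-cong (λ i → cong (_* Q (punchIn l i) t) (insertAt-punchIn c l v i))))

  module _ {d : ℕ} where

    generator-in-span : ∀ {k} (Q : Fin (suc k) → ℚPt d) i → InSpan Q (Q i)
    generator-in-span {k} Q i = unit , sum-unit , comb-unit
      where
        unit : Fin (suc _) → ℚ
        unit = insertAt (λ _ → 0ℚ) i 1ℚ
        sum-unit : sumℚ unit ≡ 1ℚ
        sum-unit = trans (sum-insertAt (λ _ → 0ℚ) i 1ℚ) (cong (1ℚ +_) (sum-zero {k}))
        comb-unit : ∀ t → comb Q unit t ≡ Q i t
        comb-unit t = trans (comb-insertAt Q (λ _ → 0ℚ) i 1ℚ t)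
          (trans (cong (1ℚ * Q i t +_) (comb-zero (Q ∘ punchIn i) t))
                 (solve 1 (λ q → con 1ℚ :* q :+ con 0ℚ := q) refl (Q i t)))

    single-weight : (Q : Fin 1 → ℚPt d) {z : ℚPt d} → (w : InSpan Q z) → proj₁ w zero ≢ 0ℚ
    single-weight Q (a , sa , _) a₀≡0 = 1≢0 (begin
        1ℚ          ≡⟨ sym sa ⟩
        a zero + 0ℚ ≡⟨ cong (_+ 0ℚ) a₀≡0 ⟩
        0ℚ + 0ℚ     ≡⟨ +-identityʳ 0ℚ ⟩
        0ℚ          ∎)
      where open ≡-Reasoning

    independent-not-in-span-of-rest : ∀ {k} (Q : Fin (suc (suc k)) → ℚPt d) → AffInd Q →
      ∀ l → ¬ InSpan (Q ∘ punchIn l) (Q l)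
    independent-not-in-span-of-rest Q aff l (a , sa , az) =
      1≢0 (trans (sym (insertAt-lookup (λ i → - 1ℚ * a i) l 1ℚ)) (aff c sum-c comb-c l))
      where
        c : Fin (suc (suc _)) → ℚ
        c = insertAt (λ i → - 1ℚ * a i) l 1ℚ
        sum-c : sumℚ c ≡ 0ℚ
        sum-c = trans (sum-insertAt _ l 1ℚ)
          (cong (1ℚ +_) (trans (sum-scale (- 1ℚ) a) (cong (- 1ℚ *_) sa)))
        comb-c : ∀ t → comb Q c t ≡ 0ℚ
        comb-c t = trans (comb-insertAt Q _ l 1ℚ t)
          (trans (cong (1ℚ * Q l t +_) (trans (comb-scale (Q ∘ punchIn l) (- 1ℚ) a t)
                                              (cong (- 1ℚ *_) (az t))))
                 (solve 1 (λ q → con 1ℚ :* q :+ :- con 1ℚ :* q := con 0ℚ) refl (Q l t)))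

    independent-distinct : ∀ {k} (Q : Fin (suc (suc k)) → ℚPt d) → AffInd Q →
      ∀ l i → ¬ (∀ t → Q l t ≡ Q (punchIn l i) t)
    independent-distinct Q aff l i Ql≡Qi with generator-in-span (Q ∘ punchIn l) i
    ... | a , sa , az =
      independent-not-in-span-of-rest Q aff l (a , sa , λ t → trans (az t) (sym (Ql≡Qi t)))

    -- Subfamilies of independent families are independent (pad with weight 0).
    drop-independent : ∀ {k} (Q : Fin (suc (suc k)) → ℚPt d) → AffInd Q →
      ∀ l → AffInd (Q ∘ punchIn l)
    drop-independent Q aff l c sc cz i =
      trans (sym (insertAt-punchIn c l 0ℚ i)) (aff (insertAt c l 0ℚ) sum0 comb0 (punchIn l i))
      where
        sum0 : sumℚ (insertAt c l 0ℚ) ≡ 0ℚ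
        sum0 = trans (sum-insertAt c l 0ℚ) (trans (+-identityˡ _) sc)
        comb0 : ∀ t → comb Q (insertAt c l 0ℚ) t ≡ 0ℚ
        comb0 t = trans (comb-insertAt Q c l 0ℚ t)
          (trans (cong (_+ comb (Q ∘ punchIn l) c t) (*-zeroˡ (Q l t)))
                 (trans (+-identityˡ _) (cz t)))

    drop-span : ∀ {k} (Q : Fin (suc (suc k)) → ℚPt d) {z : ℚPt d} (l : Fin (suc (suc k))) →
      (w : InSpan Q z) → proj₁ w l ≡ 0ℚ → InSpan (Q ∘ punchIn l) z
    drop-span Q l (a , sa , az) al≡0 =
        a ∘ punchIn l
      , trans (sum-drop-zero l a al≡0) sa
      , λ t → trans (sum-drop-zero l (λ i → a i * Q i t) (trans (cong (_* Q l t) al≡0) (*-zeroˡ (Q l t))))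
                    (az t)

  Replaces : ∀ {d k} → (Q' Q : Fin (suc k) → ℚPt d) → Fin (suc k) → ℚPt d → Set
  Replaces Q' Q l p = (∀ t → Q' l t ≡ p t) × (∀ i t → Q' (punchIn l i) t ≡ Q (punchIn l i) t)

  module Exchange {d k : ℕ} {Q Q' : Fin (suc k) → ℚPt d} {l : Fin (suc k)} {p : ℚPt d}
                  (w : InSpan Q p) (rep : Replaces Q' Q l p) where

    a : Fin (suc k) → ℚ
    a = proj₁ w

    sum-a : sumℚ a ≡ 1ℚ
    sum-a = proj₁ (proj₂ w)

    comb-a : ∀ t → comb Q a t ≡ p t
    comb-a = proj₂ (proj₂ w)

    -- Substituting p = Σᵢ aᵢ Qᵢ turns weights e on Q' into weights expand e on Q.
    expand : (Fin (suc k) → ℚ) → Fin (suc k) → ℚ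
    expand e = insertAt (λ i → e (punchIn l i) + e l * a (punchIn l i)) l (e l * a l)

    expand-sum : ∀ e → sumℚ (expand e) ≡ sumℚ e
    expand-sum e = begin
        sumℚ (expand e)
      ≡⟨ sum-insertAt _ l (e l * a l) ⟩
        e l * a l + sumℚ (λ i → e (punchIn l i) + e l * a (punchIn l i))
      ≡⟨ cong (e l * a l +_) (sum-linear (e ∘ punchIn l) (a ∘ punchIn l) (e l)) ⟩
        e l * a l + (sumℚ (e ∘ punchIn l) + e l * sumℚ (a ∘ punchIn l))
      ≡⟨ solve 4 (λ x y E A → x :* y :+ (E :+ x :* A) := x :* (y :+ A) :+ E)
               refl (e l) (a l) (sumℚ (e ∘ punchIn l)) (sumℚ (a ∘ punchIn l)) ⟩
        e l * (a l + sumℚ (a ∘ punchIn l)) + sumℚ (e ∘ punchIn l)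
      ≡⟨ cong (λ s → e l * s + sumℚ (e ∘ punchIn l)) (trans (sym (sum-punchIn l a)) sum-a) ⟩
        e l * 1ℚ + sumℚ (e ∘ punchIn l)
      ≡⟨ cong (_+ sumℚ (e ∘ punchIn l)) (*-identityʳ (e l)) ⟩
        e l + sumℚ (e ∘ punchIn l)
      ≡⟨ sym (sum-punchIn l e) ⟩
        sumℚ e
      ∎
      where open ≡-Reasoning

    expand-comb : ∀ e t → comb Q (expand e) t ≡ comb Q' e t
    expand-comb e t = begin
        comb Q (expand e) t
      ≡⟨ comb-insertAt Q _ l (e l * a l) t ⟩
        e l * a l * Q l t + comb Q₋ (λ i → e (punchIn l i) + e l * a (punchIn l i)) t
      ≡⟨ cong (e l * a l * Q l t +_) (comb-linear Q₋ (e ∘ punchIn l) (a ∘ punchIn l) (e l) t) ⟩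
        e l * a l * Q l t + (comb Q₋ (e ∘ punchIn l) t + e l * comb Q₋ (a ∘ punchIn l) t)
      ≡⟨ solve 5 (λ x y q E A → x :* y :* q :+ (E :+ x :* A) := x :* (y :* q :+ A) :+ E)
               refl (e l) (a l) (Q l t) (comb Q₋ (e ∘ punchIn l) t) (comb Q₋ (a ∘ punchIn l) t) ⟩
        e l * (a l * Q l t + comb Q₋ (a ∘ punchIn l) t) + comb Q₋ (e ∘ punchIn l) t
      ≡⟨ cong (λ s → e l * s + comb Q₋ (e ∘ punchIn l) t)
              (trans (sym (sum-punchIn l (λ i → a i * Q i t))) (comb-a t)) ⟩
        e l * p t + comb Q₋ (e ∘ punchIn l) t
      ≡⟨ cong₂ _+_ (cong (e l *_) (sym (proj₁ rep t)))
                   (sum-cong (λ i → cong (e (punchIn l i) *_) (sym (proj₂ rep i t)))) ⟩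
        e l * Q' l t + comb (Q' ∘ punchIn l) (e ∘ punchIn l) t
      ≡⟨ sym (sum-punchIn l (λ i → e i * Q' i t)) ⟩
        comb Q' e t
      ∎
      where
        open ≡-Reasoning
        Q₋ : Fin k → ℚPt d
        Q₋ = Q ∘ punchIn l

    module _ (aₗ≢0 : a l ≢ 0ℚ) where

      aₗ⁻¹ : ℚ
      aₗ⁻¹ = 1/ (a l)
        where instance _ = ≢-nonZero aₗ≢0

      aₗ⁻¹-inverse : aₗ⁻¹ * a l ≡ 1ℚ
      aₗ⁻¹-inverse = *-inverseˡ (a l)
        where instance _ = ≢-nonZero aₗ≢0

      -- Weights on Q' that expand to given weights b on Q: solve for the weight of p first.
      unexpand : (Fin (suc k) → ℚ) → Fin (suc k) → ℚ
      unexpand b = insertAt (λ i → b (punchIn l i) + - r * a (punchIn l i)) l r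
        where r = b l * aₗ⁻¹

      expand-unexpand : ∀ b j → expand (unexpand b) j ≡ b j
      expand-unexpand b = every-index l at-l at-rest
        where
          open ≡-Reasoning
          e = unexpand b
          r = b l * aₗ⁻¹
          eₗ≡r : e l ≡ r
          eₗ≡r = insertAt-lookup _ l r
          at-l : expand e l ≡ b l
          at-l = begin
              expand e l            ≡⟨ insertAt-lookup _ l (e l * a l) ⟩
              e l * a l             ≡⟨ cong (_* a l) eₗ≡r ⟩
              b l * aₗ⁻¹ * a l      ≡⟨ *-assoc (b l) aₗ⁻¹ (a l) ⟩
              b l * (aₗ⁻¹ * a l)    ≡⟨ cong (b l *_) aₗ⁻¹-inverse ⟩
              b l * 1ℚ              ≡⟨ *-identityʳ (b l) ⟩
              b l                   ∎
          at-rest : ∀ i → expand e (punchIn l i) ≡ b (punchIn l i)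
          at-rest i = begin
              expand e (punchIn l i)
            ≡⟨ insertAt-punchIn _ l (e l * a l) i ⟩
              e (punchIn l i) + e l * a (punchIn l i)
            ≡⟨ cong₂ (λ u v → u + v * a (punchIn l i)) (insertAt-punchIn _ l r i) eₗ≡r ⟩
              b (punchIn l i) + - r * a (punchIn l i) + r * a (punchIn l i)
            ≡⟨ solve 3 (λ x r y → x :+ :- r :* y :+ r :* y := x) refl (b (punchIn l i)) r (a (punchIn l i)) ⟩
              b (punchIn l i)
            ∎

      exchange-span : ∀ {z} → InSpan Q z → InSpan Q' z
      exchange-span {z} (b , sb , bz) = unexpand b , sum-e , comb-e
        where
          sum-e : sumℚ (unexpand b) ≡ 1ℚ
          sum-e = trans (sym (expand-sum (unexpand b))) (trans (sum-cong (expand-unexpand b)) sb)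
          comb-e : ∀ t → comb Q' (unexpand b) t ≡ z t
          comb-e t = trans (sym (expand-comb (unexpand b) t))
                           (trans (sum-cong (λ i → cong (_* Q i t) (expand-unexpand b i))) (bz t))

      -- Q' is independent: a vanishing combination of Q' expands to one of Q, which is
      -- trivial; its l-th weight cₗaₗ = 0 forces cₗ = 0, and then the other weights vanish.
      exchange-independent : AffInd Q → AffInd Q'
      exchange-independent aff c sc cz = every-index l cₗ≡0 rest≡0
        where
          expand-c≡0 : ∀ j → expand c j ≡ 0ℚ
          expand-c≡0 = aff (expand c) (trans (expand-sum c) sc) (λ t → trans (expand-comb c t) (cz t))
          cₗ≡0 : c l ≡ 0ℚ
          cₗ≡0 = *-cancel-nonzero aₗ≢0 (trans (sym (insertAt-lookup _ l (c l * a l))) (expand-c≡0 l))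
          rest≡0 : ∀ i → c (punchIn l i) ≡ 0ℚ
          rest≡0 i = begin
              c (punchIn l i)
            ≡⟨ solve 2 (λ x y → x := x :+ con 0ℚ :* y) refl (c (punchIn l i)) (a (punchIn l i)) ⟩
              c (punchIn l i) + 0ℚ * a (punchIn l i)
            ≡⟨ cong (λ u → c (punchIn l i) + u * a (punchIn l i)) (sym cₗ≡0) ⟩
              c (punchIn l i) + c l * a (punchIn l i)
            ≡⟨ sym (insertAt-punchIn _ l (c l * a l) i) ⟩
              expand c (punchIn l i)
            ≡⟨ expand-c≡0 (punchIn l i) ⟩
              0ℚ
            ∎
            where open ≡-Reasoning

open AffineAlgebra

module Counting {d X : ℕ} .{{_ : NonZero X}} where

  open import Data.Nat using (zero; z≤n; s≤s)
  open import Data.Nat.Properties using (≤-refl; ≤-trans; n≤1+n; m≤n⇒m≤1+n; _≤?_)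
  open import Data.Fin using (zero; punchIn)
  import Data.Fin.Properties as Fin
  open import Data.Vec.Properties using (≡-dec)
  open import Data.Vec.Functional using (insertAt)
  open import Data.Vec.Functional.Properties using (insertAt-lookup; insertAt-punchIn)
  open import Data.List.Membership.Propositional using (_∈_; _∉_)
  open import Data.List.Relation.Unary.Any using (here; there)
  open import Data.Rational using (0ℚ)
  import Data.Rational.Properties as ℚ
  open import Data.Product using (Σ; ∃; _×_; _,_; proj₁; proj₂)
  open import Data.Sum using (inj₁; inj₂)
  open import Data.Empty using (⊥-elim)
  open import Function using (_∘_)
  open import Effect.Monad using (RawMonad)
  open import Level using (0ℓ)
  open import Relation.Binary.PropositionalEquality
  open import Relation.Nullary using (¬_; Dec; yes; no)
  open import Relation.Nullary.Decidable using (decidable-stable)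
  open import Relation.Nullary.Negation using (¬¬-Monad; DoubleNegation)
  open import Relation.Nullary.Decidable.Core using (¬¬-excluded-middle)
  open RawMonad (¬¬-Monad {0ℓ})

  Pt : Set
  Pt = GPt d X

  _≟ₚ_ : (p p' : Pt) → Dec (p ≡ p')
  _≟ₚ_ = ≡-dec Fin._≟_

  open import Data.List.Membership.DecPropositional _≟ₚ_ using (_∈?_)

  Covers : ∀ {k k'} → List Pt → (Fin (suc k') → Pt) → (Fin (suc k) → Pt) → Set
  Covers S q' q = ∀ z → z ∈ S → InSpan (embF q) (emb z) → InSpan (embF q') (emb z)

  count-cons : ∀ {k} {q : Fin (suc k) → Pt} {p S n} → CountIs q (p ∷ S) n →
    Σ ℕ λ n₀ → CountIs q S n₀ × n₀ ≤ n × n ≤ suc n₀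
  count-cons (cnt-in  {n = n} _ c) = n , c , n≤1+n n , ≤-refl
  count-cons (cnt-out {n = n} _ c) = n , c , ≤-refl , n≤1+n n

  count-mono : ∀ {k k'} {q : Fin (suc k) → Pt} {q' : Fin (suc k') → Pt} {S n m} →
    Covers S q' q → CountIs q S n → CountIs q' S m → n ≤ m
  count-mono cov cnt-nil       cnt-nil         = z≤n
  count-mono cov (cnt-in _ c)  (cnt-in _ c')   = s≤s (count-mono (λ z → cov z ∘ there) c c')
  count-mono cov (cnt-in i c)  (cnt-out o c')  = ⊥-elim (o (cov _ (here refl) i))
  count-mono cov (cnt-out _ c) (cnt-in _ c')   = m≤n⇒m≤1+n (count-mono (λ z → cov z ∘ there) c c')
  count-mono cov (cnt-out _ c) (cnt-out _ c')  = count-mono (λ z → cov z ∘ there) c c'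

  count-empty : ∀ {k} {q : Fin (suc k) → Pt} {S n} →
    (∀ z → z ∈ S → ¬ InSpan (embF q) (emb z)) → CountIs q S n → n ≡ 0
  count-empty none cnt-nil       = refl
  count-empty none (cnt-in i _)  = ⊥-elim (none _ (here refl) i)
  count-empty none (cnt-out _ c) = count-empty (λ z → none z ∘ there) c

  -- Every subspace has a count; classically, since membership in a span is not decided here.
  count-exists : ∀ {k} (q : Fin (suc k) → Pt) S → DoubleNegation (∃ (CountIs q S))
  count-exists q []      = pure (0 , cnt-nil)
  count-exists q (p ∷ S) = do
    (n , c) ← count-exists q S
    yes p∈f ← ¬¬-excluded-middle
      where no p∉f → pure (n , cnt-out p∉f c)
    pure (suc n , cnt-in p∈f c)

  count-swap : ∀ {k} {q : Fin (suc k) → Pt} {S₀ x y c₁ c₂} →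
    CountIs q (x ∷ S₀) c₁ → CountIs q (y ∷ S₀) c₂ → c₁ ≤ suc c₂
  count-swap cnt₁ cnt₂ with count-cons cnt₁ | count-cons cnt₂
  ... | n₁ , c₁ , _ , c≤1+n₁ | n₂ , c₂ , n₂≤c , _ =
    ≤-trans c≤1+n₁ (s≤s (≤-trans (count-mono (λ _ _ z∈f → z∈f) c₁ c₂) n₂≤c))

  Bounds : ℕ → List Pt → ℕ → Set
  Bounds i S m = ∀ k → k ≤ i → (q : Fin (suc k) → Pt) → BasisFrom S q →
    ∀ n → CountIs q S n → n ≤ m

  data Reduction {k} (S₀ : List Pt) (j : ℕ) (q : Fin (suc k) → Pt) : Set where
    no-points : (∀ z → z ∈ S₀ → ¬ InSpan (embF q) (emb z)) → Reduction S₀ j q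
    covered   : ∀ {k'} (q' : Fin (suc k') → Pt) → k' ≤ j → BasisFrom S₀ q' → Covers S₀ q' q →
                Reduction S₀ j q

  reduction-bound : ∀ {k} {q : Fin (suc k) → Pt} {S₀ y j m n} → Bounds j (y ∷ S₀) m →
    Reduction S₀ j q → CountIs q S₀ n → DoubleNegation (n ≤ m)
  reduction-bound bound (no-points none) cnt rewrite count-empty none cnt = pure z≤n
  reduction-bound {S₀ = S₀} {y} bound (covered q' k'≤j (q'∈S₀ , aff) cov) cnt = do
    (n' , cnt') ← count-exists q' (y ∷ S₀)
    let (n₀ , cnt₀ , n₀≤n' , _) = count-cons cnt'
    pure (≤-trans (count-mono cov cnt cnt₀)
           (≤-trans n₀≤n' (bound _ k'≤j q' (there ∘ q'∈S₀ , aff) n' cnt')))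

  -- If q l is the only point of q outside S₀, the other points of q lie in S₀, since
  -- q l = x and the points of an independent family are distinct.
  rest-in-S₀ : ∀ {k} {S₀ x} (q : Fin (suc k) → Pt) → BasisFrom (x ∷ S₀) q →
    ∀ l → q l ∉ S₀ → ∀ i → q (punchIn l i) ∈ S₀
  rest-in-S₀ {zero}  q _ l _ ()
  rest-in-S₀ {suc k} q (q∈ , aff) l qₗ∉S₀ i with q∈ l | q∈ (punchIn l i)
  ... | there qₗ∈S₀ | _            = ⊥-elim (qₗ∉S₀ qₗ∈S₀)
  ... | here _      | there qᵢ∈S₀ = qᵢ∈S₀
  ... | here qₗ≡x   | here qᵢ≡x   = ⊥-elim (independent-distinct (embF q) aff l i
                                     (λ t → cong (λ v → emb v t) (trans qₗ≡x (sym qᵢ≡x))))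

  Pivot : ∀ {k} → List Pt → (Fin (suc k) → Pt) → Fin (suc k) → Set
  Pivot S₀ q l = Σ Pt λ p → p ∈ S₀ × Σ (InSpan (embF q) (emb p)) λ w → proj₁ w l ≢ 0ℚ

  pivot-reduction : ∀ {k S₀ j} {q : Fin (suc k) → Pt} {l} → k ≤ j → AffInd (embF q) →
    (∀ i → q (punchIn l i) ∈ S₀) → Pivot S₀ q l → Reduction S₀ j q
  pivot-reduction {S₀ = S₀} {q = q} {l} k≤j aff rest∈S₀ (p , p∈S₀ , w , wₗ≢0) =
    covered q' k≤j (q'∈S₀ , exchange-independent wₗ≢0 aff) (λ _ _ → exchange-span wₗ≢0)
    where
      q' : Fin _ → Pt
      q' = insertAt (q ∘ punchIn l) l p
      q'∈S₀ : ∀ j → q' j ∈ S₀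
      q'∈S₀ = every-index l (subst (_∈ S₀) (sym (insertAt-lookup _ l p)) p∈S₀)
                            (λ i → subst (_∈ S₀) (sym (insertAt-punchIn _ l p i)) (rest∈S₀ i))
      replaces : Replaces (embF q') (embF q) l (emb p)
      replaces = (λ t → cong (λ v → emb v t) (insertAt-lookup _ l p))
               , (λ i t → cong (λ v → emb v t) (insertAt-punchIn _ l p i))
      open Exchange {Q = embF q} {Q' = embF q'} w replaces

  -- Without a pivot, the points of S₀ in span q avoid q l: drop q l (or, if q l was the
  -- only point, span q contains no point of S₀).
  no-pivot-reduction : ∀ {k S₀ j} (q : Fin (suc k) → Pt) l → k ≤ j → AffInd (embF q) →
    (∀ i → q (punchIn l i) ∈ S₀) → ¬ Pivot S₀ q l → Reduction S₀ j q
  no-pivot-reduction {zero} q zero _ _ _ ¬pivot =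
    no-points (λ z z∈S₀ w → ¬pivot (z , z∈S₀ , w , single-weight (embF q) w))
  no-pivot-reduction {suc k} q l k≤j aff rest∈S₀ ¬pivot =
    covered (q ∘ punchIn l) (≤-trans (n≤1+n k) k≤j) (rest∈S₀ , drop-independent (embF q) aff l)
      (λ z z∈S₀ w → drop-span (embF q) l w
        (decidable-stable (proj₁ w l ℚ.≟ 0ℚ) (λ wₗ≢0 → ¬pivot (z , z∈S₀ , w , wₗ≢0))))

  reduce : ∀ {k S₀ x j} (q : Fin (suc k) → Pt) → k ≤ j → BasisFrom (x ∷ S₀) q →
    DoubleNegation (Reduction S₀ j q)
  reduce {S₀ = S₀} q k≤j basis with Fin.all? (λ l → q l ∈? S₀)
  ... | yes all∈S₀ = pure (covered q k≤j (all∈S₀ , proj₂ basis) (λ _ _ z∈f → z∈f))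
  ... | no ¬all∈S₀ = do
    let (l , qₗ∉S₀) = Fin.¬∀⟶∃¬ _ _ (λ l → q l ∈? S₀) ¬all∈S₀
        rest∈S₀ = rest-in-S₀ q basis l qₗ∉S₀
    yes pivot ← ¬¬-excluded-middle
      where no ¬pivot → pure (no-pivot-reduction q l k≤j (proj₂ basis) rest∈S₀ ¬pivot)
    pure (pivot-reduction k≤j (proj₂ basis) rest∈S₀ pivot)

  -- M_j(x ∷ S₀) ≤ M_j(y ∷ S₀) + 1: drop x from a maximising subspace and reduce it to S₀.
  M-swap : ∀ {S₀ x y j m₁ m₂} → IsM j (x ∷ S₀) m₁ → IsM j (y ∷ S₀) m₂ → m₁ ≤ suc m₂
  M-swap (inj₁ refl , _) _ = z≤n
  M-swap {m₁ = m₁} {m₂} (inj₂ (k , k≤j , q , basis , cnt) , _) (_ , bound)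
    with count-cons cnt
  ... | n₀ , cnt₀ , _ , m₁≤1+n₀ = decidable-stable (m₁ ≤? suc m₂) (do
    reduction ← reduce q k≤j basis
    n₀≤m₂ ← reduction-bound bound reduction cnt₀
    pure (≤-trans m₁≤1+n₀ (s≤s n₀≤m₂)))

open Counting

module Arithmetic where

  open import Data.Nat using (_+_; _∸_; s≤s)
  open import Data.Nat.Properties
    using (+-monoˡ-≤; m≤n+m∸n; m≤n+o⇒m∸n≤o; ∣m-n∣≡[m∸n]∨[n∸m]; module ≤-Reasoning)
  open import Data.Nat.Solver using (module +-*-Solver)
  open +-*-Solver
  open import Data.Sum using (inj₁; inj₂)
  open import Relation.Binary.PropositionalEquality using (refl; sym; subst)

  ∣-∣-bound : ∀ {a b k} → a ≤ b + k → b ≤ a + k → ∣ a - b ∣ ≤ k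
  ∣-∣-bound {a} {b} a≤b+k b≤a+k with ∣m-n∣≡[m∸n]∨[n∸m] a b
  ... | inj₁ eq = subst (_≤ _) (sym eq) (m≤n+o⇒m∸n≤o a b a≤b+k)
  ... | inj₂ eq = subst (_≤ _) (sym eq) (m≤n+o⇒m∸n≤o b a b≤a+k)

  ∸-swap-bound : ∀ {c₁ c₂ m₁ m₂} → c₁ ≤ suc c₂ → m₂ ≤ suc m₁ → c₁ ∸ m₁ ≤ (c₂ ∸ m₂) + 2
  ∸-swap-bound {c₁} {c₂} {m₁} {m₂} c₁≤1+c₂ m₂≤1+m₁ = m≤n+o⇒m∸n≤o c₁ m₁ (begin
      c₁                          ≤⟨ c₁≤1+c₂ ⟩
      suc c₂                      ≤⟨ s≤s (m≤n+m∸n c₂ m₂) ⟩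
      suc (m₂ + (c₂ ∸ m₂))        ≤⟨ s≤s (+-monoˡ-≤ (c₂ ∸ m₂) m₂≤1+m₁) ⟩
      suc (suc m₁ + (c₂ ∸ m₂))    ≡⟨ solve 2 (λ m r → con 2 :+ (m :+ r) := m :+ (r :+ con 2)) refl m₁ (c₂ ∸ m₂) ⟩
      m₁ + ((c₂ ∸ m₂) + 2)        ∎)
    where open ≤-Reasoning

open Arithmetic

module Scores where

  open import Data.Nat using (_+_; z≤n)

  -- Swapping x for y lowers the score of a fixed subspace by at most 2: the count drops by
  -- at most one and M_{j-1} rises by at most one (for j = 0 the score is the count, c ∸ 0).
  score-swap : ∀ {d X} .{{_ : NonZero X}} {S₀ : List (GPt d X)} {x y j q s₁ s₂} →
    Score (x ∷ S₀) j q s₁ → Score (y ∷ S₀) j q s₂ → s₁ ≤ s₂ + 2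
  score-swap (score-zero cnt₁) (score-zero cnt₂) = ∸-swap-bound {m₁ = 0} (count-swap cnt₁ cnt₂) z≤n
  score-swap (score-suc cnt₁ isM₁) (score-suc cnt₂ isM₂) =
    ∸-swap-bound (count-swap cnt₁ cnt₂) (M-swap isM₂ isM₁)

open Scores

-- The theorem: apply score-swap in both directions.
lemma11 : (d X : ℕ) .{{_ : NonZero X}} (S₀ : List (GPt d X)) (x y : GPt d X)
    (j : ℕ) → j < d → (q : Fin (suc j) → GPt d X) → AffInd (embF q) →
    (s₁ s₂ : ℕ) → Score (x ∷ S₀) j q s₁ → Score (y ∷ S₀) j q s₂ →
    ∣ s₁ - s₂ ∣ ≤ 2
lemma11 d X S₀ x y j _ q _ s₁ s₂ score₁ score₂ =
  ∣-∣-bound (score-swap score₁ score₂) (score-swap score₂ score₁)
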